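{- Let $K\ge1$, let $A<B$ be integers and let $\varphi:\{A,\ldots,B\}\to\mathbb{Z}^{+}$ be nondecreasing. Let $\mathrm{Inc}_\varphi$ be any set with $\mathrm{StrictInc}_\varphi\subseteq\mathrm{Inc}_\varphi\subseteq\{A,\ldots,B\}$, and let $W^{\mathrm{inc}}$ be a $K$-approximation set of $\varphi^{\mathrm{inc}}$. Let $W=\mathrm{pad}(\mathrm{dom}(W^{\mathrm{inc}}))$. Then $W$ is a $K$-approximation set of $\varphi$.
   Context: Let $\psi:\{a,\ldots,b\}\to\mathbb{Z}^{+}$ be nondecreasing and $K\ge1$. A set $W=\{w_1<w_2<\cdots<w_r\}\subseteq\{a,\ldots,b\}$ with $w_1=a$, $w_r=b$ is a $K$-approximation set of $\psi$ if $\psi(w_{j+1})\le K\psi(w_j)$ for every $j=1,\ldots,r-1$ with $w_{j+1}-w_j>1$. For nondecreasing $\varphi:\{A,\ldots,B\}\to\mathbb{Z}^{+}$: $\mathrm{StrictInc}_\varphi=\{A,B\}\cup\{i\in\mathbb{Z}: A+1\le i\le B,\ \varphi(i)>\varphi(i-1)\}$. Given a set $\mathrm{Inc}_\varphi$ with $\mathrm{StrictInc}_\varphi\subseteq\mathrm{Inc}_\varphi\subseteq\{A,\ldots,B\}$ with elements $A=k_1<k_2<\cdots<k_{|\mathrm{Inc}_\varphi|}=B$, define $\varphi^{\mathrm{dom}}:\{1,\ldots,|\mathrm{Inc}_\varphi|\}\to\{A,\ldots,B\}$ by $\varphi^{\mathrm{dom}}(j)=k_j$, and $\varphi^{\mathrm{inc}}:\{1,\ldots,|\mathrm{Inc}_\varphi|\}\to\mathbb{Z}^{+}$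 by $\varphi^{\mathrm{inc}}(j)=\varphi(\varphi^{\mathrm{dom}}(j))$. For a set $W^{\mathrm{inc}}\subseteq\{1,\ldots,|\mathrm{Inc}_\varphi|\}$, $\mathrm{dom}(W^{\mathrm{inc}})=\{\varphi^{\mathrm{dom}}(w): w\in W^{\mathrm{inc}}\}$. For $S=\{s_1<\cdots<s_{|S|}\}\subseteq\{A,\ldots,B\}$, $\mathrm{pad}(S)=\{s_1\}\cup\{s_i,\,s_i-1: 2\le i\le |S|\}$. $\mathbb{Z}^{+}=\{0,1,2,\ldots\}$.
   Formalization: The approximation constant $K\ge1$ is taken to be rational. -}

module Defs where

open import Data.Nat as ℕ using (ℕ; zero; suc)
open import Data.Integer as ℤ using (ℤ; +_; 1ℤ; _+_; _-_; ∣_∣)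
open import Data.Rational as ℚ using (ℚ; _/_)
open import Data.List using (List; []; _∷_)
open import Data.Sum using (_⊎_)
open import Data.Product using (_×_; ∃; _,_)
open import Relation.Nullary using (¬_)
open import Relation.Binary.PropositionalEquality using (_≡_)

ℤSet : Set₁
ℤSet = ℤ → Set

toℚ : ℕ → ℚ
toℚ n = (+ n) / 1

InRange : ℤ → ℤ → ℤ → Set
InRange a b x = a ℤ.≤ x × x ℤ.≤ b

Consecutive : ℤSet → ℤ → ℤ → Set
Consecutive W w w' = W w × W w' × w ℤ.< w' × (∀ x → W x → w ℤ.< x → ¬ (x ℤ.< w'))

-- W is a K-approximation set of ψ : {a,…,b} → ℤ⁺
-- (ψ is given on all of ℤ; only its values on {a,…,b} matter)
IsApproxSet : ℚ → ℤ → ℤ → (ℤ → ℕ) → ℤSet → Set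
IsApproxSet K a b ψ W =
  (∀ x → W x → InRange a b x) × W a × W b ×
  (∀ w w' → Consecutive W w w' → 1ℤ ℤ.< w' - w →
     toℚ (ψ w') ℚ.≤ K ℚ.* toℚ (ψ w))

Nondecreasing : ℤ → ℤ → (ℤ → ℕ) → Set
Nondecreasing A B φ = ∀ i j → A ℤ.≤ i → i ℤ.≤ j → j ℤ.≤ B → φ i ℕ.≤ φ j

StrictInc : ℤ → ℤ → (ℤ → ℕ) → ℤSet
StrictInc A B φ i =
  (i ≡ A) ⊎ ((i ≡ B) ⊎ (A + 1ℤ ℤ.≤ i × i ℤ.≤ B × φ (i - 1ℤ) ℕ.< φ i))

-- The set Inc_φ is given by its increasing enumeration ks = [k₁,…,k_n].
-- nth ks m = k_{m+1} (0-based), with an irrelevant default outside the range.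
nth : List ℤ → ℕ → ℤ
nth []       _       = + 0
nth (k ∷ ks) zero    = k
nth (k ∷ ks) (suc m) = nth ks m

φdom : List ℤ → ℤ → ℤ
φdom ks j = nth ks ∣ j - 1ℤ ∣

φinc : List ℤ → (ℤ → ℕ) → ℤ → ℕ
φinc ks φ j = φ (φdom ks j)

dom : List ℤ → ℤSet → ℤSet
dom ks Winc x = ∃ λ w → Winc w × x ≡ φdom ks w

-- pad(S) = {s₁} ∪ {s_i, s_i - 1 : i ≥ 2}, where s₁ = min S:
-- x ∈ pad(S) iff x ∈ S, or x+1 ∈ S and x+1 is not the minimum of S.
pad : ℤSet → ℤSet
pad S x = S x ⊎ (S (x + 1ℤ) × ∃ λ s → S s × s ℤ.< x + 1ℤ)

-- Consecutive points w < w' of pad(dom W^inc) with w' − w > 1 are forced into the shape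
-- w = k_a ∈ dom W^inc and w' + 1 = k_b ∈ dom W^inc with no point of dom W^inc in between.
-- If b = a + 1 then no point of Inc_φ, hence of StrictInc_φ, lies strictly between w and
-- w' + 1, so φ is constant on {w,…,w'}. Otherwise a + 1 and b + 1 are consecutive in W^inc
-- with a gap, so φ(w') ≤ φ(k_b) ≤ K φ(k_a).
module Submission where

open import Defs
open import Data.Nat as ℕ using (ℕ; zero; suc; s≤s)
import Data.Nat.Properties as ℕₚ
open import Data.Nat.Coprimality using (1-coprimeTo) renaming (sym to coprime-sym)
open import Data.Integer using (ℤ; +_; -[1+_]; 1ℤ; _+_; _-_; -_; _<_; _≤_; ∣_∣; +≤+; +<+)
import Data.Integer.Properties as ℤₚ
open import Data.Integer.Tactic.RingSolver using (solve-∀)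
open import Data.Rational as ℚ using (ℚ; 1ℚ; mkℚ) renaming (_≤_ to _≤ℚ_)
import Data.Rational.Properties as ℚₚ
open import Data.List using (List; _∷_; length)
open import Data.List.Relation.Unary.All as All using ()
open import Data.List.Relation.Unary.Linked using (Linked)
open import Data.List.Relation.Unary.Linked.Properties using (Linked⇒AllPairs)
open import Data.List.Relation.Unary.AllPairs using (AllPairs; _∷_)
open import Data.List.Membership.Propositional using (_∈_)
open import Data.List.Relation.Unary.Any using (here; there)
open import Data.Product using (_×_; _,_; ∃; proj₁; proj₂)
open import Data.Sum using (inj₁; inj₂)
open import Data.Empty using (⊥-elim)
open import Relation.Nullary using (¬_; yes; no)
open import Relation.Binary.Definitions using (tri<; tri≈; tri>)
open import Relation.Binary.PropositionalEquality

i+1-1≡i : ∀ i → (i + 1ℤ) - 1ℤ ≡ i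
i+1-1≡i = solve-∀

i-1+1≡i : ∀ i → (i - 1ℤ) + 1ℤ ≡ i
i-1+1≡i = solve-∀

i+1≤j⇒i<j : ∀ {i j} → i + 1ℤ ≤ j → i < j
i+1≤j⇒i<j {i} {j} p = ℤₚ.suc[i]≤j⇒i<j (subst (_≤ j) (ℤₚ.+-comm i 1ℤ) p)

i<j⇒i+1≤j : ∀ {i j} → i < j → i + 1ℤ ≤ j
i<j⇒i+1≤j {i} {j} p = subst (_≤ j) (ℤₚ.+-comm 1ℤ i) (ℤₚ.i<j⇒suc[i]≤j p)

i<j+1⇒i≤j : ∀ {i j} → i < j + 1ℤ → i ≤ j
i<j+1⇒i≤j {i} {j} p =
  subst₂ _≤_ (i+1-1≡i i) (i+1-1≡i j) (ℤₚ.+-monoˡ-≤ (- 1ℤ) (i<j⇒i+1≤j p))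

i<i+1 : ∀ i → i < i + 1ℤ
i<i+1 i = i+1≤j⇒i<j ℤₚ.≤-refl

i-1<i : ∀ i → i - 1ℤ < i
i-1<i i = i+1≤j⇒i<j (ℤₚ.≤-reflexive (i-1+1≡i i))

1<j-i⇒i+1<j : ∀ {i j} → 1ℤ < j - i → i + 1ℤ < j
1<j-i⇒i+1<j {i} {j} p = subst₂ _<_ (ℤₚ.+-comm 1ℤ i) (j-i+i≡j i j) (ℤₚ.+-monoˡ-< i p)
  where
  j-i+i≡j : ∀ i j → (j - i) + i ≡ j
  j-i+i≡j = solve-∀

i+1<j⇒1<j-i : ∀ {i j} → i + 1ℤ < j → 1ℤ < j - i
i+1<j⇒1<j-i {i} {j} p = subst (_< j - i) (i+1-i≡1 i) (ℤₚ.+-monoˡ-< (- i) p)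
  where
  i+1-i≡1 : ∀ i → (i + 1ℤ) - i ≡ 1ℤ
  i+1-i≡1 = solve-∀

i+1<j⇒i<j-1 : ∀ {i j} → i + 1ℤ < j → i < j - 1ℤ
i+1<j⇒i<j-1 {i} {j} p = i+1≤j⇒i<j (i<j+1⇒i≤j (subst (i + 1ℤ <_) (sym (i-1+1≡i j)) p))

i≤j⇒i+∣i-j∣≡j : ∀ {i j} → i ≤ j → i + + ∣ i - j ∣ ≡ j
i≤j⇒i+∣i-j∣≡j {i} {j} p = trans (cong (λ k → i + k) (ℤₚ.∣-∣-≤ p)) (i+[j-i]≡j i j)
  where
  i+[j-i]≡j : ∀ i j → i + (j - i) ≡ j
  i+[j-i]≡j = solve-∀

i+[1+d]≡i+d+1 : ∀ i d → i + + suc d ≡ (i + + d) + 1ℤ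
i+[1+d]≡i+d+1 i d = trans (cong (λ k → i + + k) (ℕₚ.+-comm 1 d)) (sym (ℤₚ.+-assoc i (+ d) 1ℤ))

toℚ≡mkℚ : ∀ n → toℚ n ≡ mkℚ (+ n) 0 (coprime-sym (1-coprimeTo n))
toℚ≡mkℚ n = ℚₚ.normalize-coprime (coprime-sym (1-coprimeTo n))

toℚ-mono : ∀ {m n} → m ℕ.≤ n → toℚ m ≤ℚ toℚ n
toℚ-mono {m} {n} p rewrite toℚ≡mkℚ m | toℚ≡mkℚ n =
  ℚ.*≤* (subst₂ _≤_ (sym (ℤₚ.*-identityʳ (+ m))) (sym (ℤₚ.*-identityʳ (+ n))) (+≤+ p))

toℚ≤K*toℚ : ∀ {K} → 1ℚ ≤ℚ K → ∀ n → toℚ n ≤ℚ K ℚ.* toℚ n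
toℚ≤K*toℚ {K} 1≤K n = subst (_≤ℚ K ℚ.* toℚ n) (ℚₚ.*-identityˡ (toℚ n))
  (ℚₚ.*-monoʳ-≤-nonNeg (toℚ n) {{ℚₚ.normalize-nonNeg n 1}} 1≤K)

nth∈ : ∀ ks m → m ℕ.< length ks → nth ks m ∈ ks
nth∈ (k ∷ ks) zero    _         = here refl
nth∈ (k ∷ ks) (suc m) (s≤s m<n) = there (nth∈ ks m m<n)

∈⇒nth : ∀ {x : ℤ} {ks} → x ∈ ks → ∃ λ m → m ℕ.< length ks × nth ks m ≡ x
∈⇒nth (here refl) = zero , s≤s ℕ.z≤n , refl
∈⇒nth (there x∈ks) with ∈⇒nth x∈ks
... | m , m<n , refl = suc m , s≤s m<n , refl

nth-strictMono : ∀ {ks} → AllPairs _<_ ks → ∀ {i j} → i ℕ.< j → j ℕ.< length ks →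
                 nth ks i < nth ks j
nth-strictMono {k ∷ ks} (k<ks ∷ _) {zero} {suc j} _ (s≤s j<n) = All.lookup k<ks (nth∈ ks j j<n)
nth-strictMono {k ∷ ks} (_ ∷ ks↑) {suc i} {suc j} (s≤s i<j) (s≤s j<n) =
  nth-strictMono ks↑ i<j j<n

module _ {ks : List ℤ} (ks↑ : AllPairs _<_ ks) where

  nth-cancel-< : ∀ {i j} → i ℕ.< length ks → nth ks i < nth ks j → i ℕ.< j
  nth-cancel-< {i} {j} i<n lt with ℕₚ.<-cmp i j
  ... | tri< i<j _ _    = i<j
  ... | tri≈ _ refl _   = ⊥-elim (ℤₚ.<-irrefl refl lt)
  ... | tri> _ _ j<i    = ⊥-elim (ℤₚ.<-asym lt (nth-strictMono ks↑ j<i i<n))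

  nth-cancel-≤ : ∀ {i j} → i ℕ.< length ks → nth ks i ≤ nth ks j → i ℕ.≤ j
  nth-cancel-≤ {i} {j} i<n le with j ℕ.<? i
  ... | yes j<i = ⊥-elim (ℤₚ.<⇒≱ (nth-strictMono ks↑ j<i i<n) le)
  ... | no  j≮i = ℕₚ.≮⇒≥ j≮i

  nothing-between-neighbours : ∀ {a x} → a ℕ.< length ks → x ∈ ks →
                               nth ks a < x → ¬ (x < nth ks (suc a))
  nothing-between-neighbours a<n x∈ks k<x x<k′ with ∈⇒nth x∈ks
  ... | m , m<n , refl =
    ℕₚ.<⇒≱ (nth-cancel-< a<n k<x) (ℕₚ.m<1+n⇒m≤n (nth-cancel-< m<n x<k′))

pad-range : ∀ {S A B} → (∀ x → S x → InRange A B x) → ∀ x → pad S x → InRange A B x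
pad-range S⊆ x (inj₁ Sx) = S⊆ x Sx
pad-range S⊆ x (inj₂ (Sx+1 , s , Ss , s<x+1)) =
  ℤₚ.≤-trans (proj₁ (S⊆ s Ss)) (i<j+1⇒i≤j s<x+1) ,
  ℤₚ.≤-trans (ℤₚ.<⇒≤ (i<i+1 x)) (proj₂ (S⊆ _ Sx+1))

-- Neither w + 1 nor w' − 1 may lie in pad S, which pins down w ∈ S, w' ∉ S and w' + 1 ∈ S.
pad-gap : ∀ {S w w'} → Consecutive (pad S) w w' → 1ℤ < w' - w → Consecutive S w (w' + 1ℤ)
pad-gap {S} {w} {w'} (Pw , Pw' , w<w' , empty) gap =
  Sw Pw , Sw'+1 Pw' , ℤₚ.<-trans w<w' (i<i+1 w') , emptyS
  where
  least : pad S w → ∃ λ s → S s × s ≤ w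
  least (inj₁ Sw)                   = w , Sw , ℤₚ.≤-refl
  least (inj₂ (_ , s , Ss , s<w+1)) = s , Ss , i<j+1⇒i≤j s<w+1

  ¬Sw' : ¬ S w'
  ¬Sw' Sw' with least Pw
  ... | s , Ss , s≤w =
    empty (w' - 1ℤ) P[w'-1] (i+1<j⇒i<j-1 {w} {w'} (1<j-i⇒i+1<j {w} {w'} gap)) (i-1<i w')
    where
    P[w'-1] : pad S (w' - 1ℤ)
    P[w'-1] = inj₂ (subst S (sym (i-1+1≡i w')) Sw' , s , Ss ,
                    subst (s <_) (sym (i-1+1≡i w')) (ℤₚ.≤-<-trans s≤w w<w'))

  Sw : pad S w → S w
  Sw (inj₁ Sw)         = Sw
  Sw (inj₂ (Sw+1 , _)) = ⊥-elim (empty (w + 1ℤ) (inj₁ Sw+1) (i<i+1 w) (1<j-i⇒i+1<j {w} {w'} gap))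

  Sw'+1 : pad S w' → S (w' + 1ℤ)
  Sw'+1 (inj₁ Sw')         = ⊥-elim (¬Sw' Sw')
  Sw'+1 (inj₂ (Sw'+1 , _)) = Sw'+1

  emptyS : ∀ x → S x → w < x → ¬ (x < w' + 1ℤ)
  emptyS x Sx w<x x<w'+1 with x ℤₚ.<? w'
  ... | yes x<w' = empty x (inj₁ Sx) w<x x<w'
  ... | no  x≮w' = ¬Sw' (subst S (ℤₚ.≤-antisym (i<j+1⇒i≤j x<w'+1) (ℤₚ.≮⇒≥ x≮w')) Sx)

no-increase⇒≤ : ∀ {A B φ w t} → A ≤ w → t ≤ B →
                (∀ x → StrictInc A B φ x → w < x → ¬ (x < t)) →
                ∀ d → w + + d < t → φ (w + + d) ℕ.≤ φ w
no-increase⇒≤ {φ = φ} {w = w} _ _ _ zero _ = ℕₚ.≤-reflexive (cong φ (ℤₚ.+-identityʳ w))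
no-increase⇒≤ {A} {B} {φ} {w} {t} A≤w t≤B none (suc d) i<t
  rewrite i+[1+d]≡i+d+1 w d with φ (w + + d) ℕ.<? φ (w + + d + 1ℤ)
... | yes step = ⊥-elim (none i increase (ℤₚ.≤-<-trans (ℤₚ.i≤i+j w (+ d)) (i<i+1 _)) i<t)
  where
  i = w + + d + 1ℤ
  increase : StrictInc A B φ i
  increase = inj₂ (inj₂ (ℤₚ.+-monoˡ-≤ 1ℤ (ℤₚ.≤-trans A≤w (ℤₚ.i≤i+j w (+ d))) ,
                          ℤₚ.<⇒≤ (ℤₚ.<-≤-trans i<t t≤B) ,
                          subst (λ k → φ k ℕ.< φ i) (sym (i+1-1≡i (w + + d))) step))
... | no  flat = ℕₚ.≤-trans (ℕₚ.≮⇒≥ flat)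
                   (no-increase⇒≤ A≤w t≤B none d (ℤₚ.<-trans (i<i+1 _) i<t))

module Transfer {K : ℚ} {A B : ℤ} {φ : ℤ → ℕ} {ks : List ℤ} {Winc : ℤSet}
  (1≤K : 1ℚ ≤ℚ K) (φ↑ : Nondecreasing A B φ) (ks↑ : AllPairs _<_ ks)
  (inc⊆ks : ∀ x → StrictInc A B φ x → x ∈ ks) (ks⊆range : ∀ x → x ∈ ks → InRange A B x)
  (approx : IsApproxSet K 1ℤ (+ length ks) (φinc ks φ) Winc) where

  private
    Winc⊆range : ∀ j → Winc j → InRange 1ℤ (+ length ks) j
    Winc⊆range = proj₁ approx

    1∈Winc : Winc 1ℤ
    1∈Winc = proj₁ (proj₂ approx)

    n∈Winc : Winc (+ length ks)
    n∈Winc = proj₁ (proj₂ (proj₂ approx))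

    Winc-step : ∀ j j' → Consecutive Winc j j' → 1ℤ < j' - j →
                toℚ (φ (nth ks ∣ j' - 1ℤ ∣)) ≤ℚ K ℚ.* toℚ (φ (nth ks ∣ j - 1ℤ ∣))
    Winc-step = proj₂ (proj₂ (proj₂ approx))

  Winc-index : ∀ {j} → Winc j → ∃ λ c → c ℕ.< length ks × j ≡ + suc c
  Winc-index {+ suc c} Wj = c , ℤₚ.drop‿+≤+ (proj₂ (Winc⊆range _ Wj)) , refl
  Winc-index {+ zero} Wj with Winc⊆range _ Wj
  ... | +≤+ () , _
  Winc-index { -[1+ _ ]} Wj with Winc⊆range _ Wj
  ... | () , _

  dom-elim : ∀ {x} → dom ks Winc x → ∃ λ c → c ℕ.< length ks × Winc (+ suc c) × x ≡ nth ks c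
  dom-elim (j , Wj , refl) with Winc-index Wj
  ... | c , c<n , refl = c , c<n , Wj , refl

  dom-intro : ∀ {c} → Winc (+ suc c) → dom ks Winc (nth ks c)
  dom-intro Wc = _ , Wc , refl

  dom-range : ∀ x → dom ks Winc x → InRange A B x
  dom-range x Dx with dom-elim Dx
  ... | c , c<n , _ , refl = ks⊆range _ (nth∈ ks c c<n)

  A∈dom : dom ks Winc A
  A∈dom with ∈⇒nth (inc⊆ks A (inj₁ refl))
  ... | m , m<n , refl = subst (dom ks Winc) (cong (nth ks) (sym m≡0)) (dom-intro 1∈Winc)
    where
    m≡0 : m ≡ 0
    m≡0 = ℕₚ.n≤0⇒n≡0
      (nth-cancel-≤ ks↑ m<n (proj₁ (ks⊆range _ (nth∈ ks 0 (ℕₚ.≤-<-trans ℕ.z≤n m<n)))))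

  B∈dom : dom ks Winc B
  B∈dom with ∈⇒nth (inc⊆ks B (inj₂ (inj₁ refl))) | Winc-index n∈Winc
  ... | m , m<n , refl | c , c<n , n≡1+c =
    subst (dom ks Winc) (cong (nth ks) (sym m≡c))
      (dom-intro (subst Winc n≡1+c n∈Winc))
    where
    m≡c : m ≡ c
    m≡c = ℕₚ.≤-antisym (ℕₚ.m<1+n⇒m≤n (subst (m ℕ.<_) (ℤₚ.+-injective n≡1+c) m<n))
                       (nth-cancel-≤ ks↑ c<n (proj₂ (ks⊆range _ (nth∈ ks c c<n))))

  index-consecutive : ∀ {a b} → Consecutive (dom ks Winc) (nth ks a) (nth ks b) →
                      Winc (+ suc a) → Winc (+ suc b) → a ℕ.< b → b ℕ.< length ks →
                      Consecutive Winc (+ suc a) (+ suc b)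
  index-consecutive {a} {b} (_ , _ , _ , empty) Wa Wb a<b b<n =
    Wa , Wb , +<+ (s≤s a<b) , emptyW
    where
    emptyW : ∀ x → Winc x → + suc a < x → ¬ (x < + suc b)
    emptyW x Wx a<x x<b with Winc-index Wx
    ... | c , c<n , refl = empty (nth ks c) (dom-intro Wx)
      (nth-strictMono ks↑ (ℕₚ.≤-pred (ℤₚ.drop‿+<+ a<x)) c<n)
      (nth-strictMono ks↑ (ℕₚ.≤-pred (ℤₚ.drop‿+<+ x<b)) b<n)

  neighbours-bound : ∀ {a b w'} → a ℕ.< length ks → b ℕ.< length ks →
                     Winc (+ suc a) → Winc (+ suc b) →
                     Consecutive (dom ks Winc) (nth ks a) (nth ks b) →
                     nth ks a ≤ w' → w' < nth ks b →
                     toℚ (φ w') ≤ℚ K ℚ.* toℚ (φ (nth ks a))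
  neighbours-bound {a} {b} {w'} a<n b<n Wa Wb cons ka≤w' w'<kb
    with ℕₚ.m≤n⇒m<n∨m≡n (nth-cancel-< ks↑ a<n (proj₁ (proj₂ (proj₂ cons))))
  ... | inj₂ refl = ℚₚ.≤-trans (toℚ-mono φw'≤φka) (toℚ≤K*toℚ 1≤K (φ (nth ks a)))
    where
    w'≡ka+d : nth ks a + + ∣ nth ks a - w' ∣ ≡ w'
    w'≡ka+d = i≤j⇒i+∣i-j∣≡j ka≤w'
    φw'≤φka : φ w' ℕ.≤ φ (nth ks a)
    φw'≤φka = subst (λ i → φ i ℕ.≤ φ (nth ks a)) w'≡ka+d
      (no-increase⇒≤ (proj₁ (ks⊆range _ (nth∈ ks a a<n))) (proj₂ (ks⊆range _ (nth∈ ks b b<n)))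
        (λ x inc → nothing-between-neighbours ks↑ a<n (inc⊆ks x inc))
        _ (subst (_< nth ks b) (sym w'≡ka+d) w'<kb))
  ... | inj₁ 1+a<b = ℚₚ.≤-trans (toℚ-mono φw'≤φkb)
                       (Winc-step _ _ (index-consecutive cons Wa Wb a<b b<n) gap)
    where
    a<b : a ℕ.< b
    a<b = ℕₚ.<-trans (ℕₚ.n<1+n a) 1+a<b
    gap : 1ℤ < + suc b - + suc a
    gap = i+1<j⇒1<j-i {+ suc a} (+<+ (subst (ℕ._< suc b) (ℕₚ.+-comm 1 (suc a)) (s≤s 1+a<b)))
    φw'≤φkb : φ w' ℕ.≤ φ (nth ks b)
    φw'≤φkb = φ↑ w' (nth ks b) (ℤₚ.≤-trans (proj₁ (ks⊆range _ (nth∈ ks a a<n))) ka≤w')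
                (ℤₚ.<⇒≤ w'<kb) (proj₂ (ks⊆range _ (nth∈ ks b b<n)))

  dom-consecutive-bound : ∀ {w t w'} → Consecutive (dom ks Winc) w t → w ≤ w' → w' < t →
                          toℚ (φ w') ≤ℚ K ℚ.* toℚ (φ w)
  dom-consecutive-bound cons@(Dw , Dt , _) with dom-elim Dw | dom-elim Dt
  ... | a , a<n , Wa , refl | b , b<n , Wb , refl = neighbours-bound a<n b<n Wa Wb cons

mainTheorem4 : (K : ℚ) → 1ℚ ≤ℚ K →
    (A B : ℤ) → A < B →
    (φ : ℤ → ℕ) → Nondecreasing A B φ →
    (ks : List ℤ) → Linked _<_ ks →
    (∀ x → StrictInc A B φ x → x ∈ ks) →
    (∀ x → x ∈ ks → InRange A B x) →
    (Winc : ℤSet) → IsApproxSet K 1ℤ (+ length ks) (φinc ks φ) Winc →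
    IsApproxSet K A B φ (pad (dom ks Winc))
mainTheorem4 K 1≤K A B _ φ φ↑ ks ks↑ inc⊆ks ks⊆range Winc approx =
  pad-range dom-range , inj₁ A∈dom , inj₁ B∈dom ,
  λ w w' cons gap → dom-consecutive-bound (pad-gap cons gap)
                      (ℤₚ.<⇒≤ (proj₁ (proj₂ (proj₂ cons)))) (i<i+1 w')
  where
  sorted : AllPairs _<_ ks
  sorted = Linked⇒AllPairs ℤₚ.<-trans ks↑
  open Transfer 1≤K φ↑ sorted inc⊆ks ks⊆range approx
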